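{- Let $\beta$ be a Naji solution for a graph $G$. Then $\beta+\rho$ is a Naji solution of $G$, and for each $v\in V(G)$, $\beta+\delta(v)$ is a Naji solution of $G$.
   Context: All graphs are finite and simple. For a graph $G$ and each ordered pair $(v,w)$ of distinct vertices there is a variable $\beta(v,w)$. The Naji equations of $G$ are: (a) for each edge $vw$, $\beta(v,w)+\beta(w,v)=1$; (b) if $v,w,x$ are distinct with $vw\in E(G)$ and $vx,wx\notin E(G)$, then $\beta(x,v)+\beta(x,w)=0$; (c) if $v,w,x$ are distinct with $vw,vx\in E(G)$ and $wx\notin E(G)$, then $\beta(v,w)+\beta(v,x)+\beta(w,x)+\beta(x,w)=1$. A Naji solution is a function $\beta$ from ordered pairs of distinct vertices to $GF(2)$ satisfying all these equations. For $v\in V(G)$, $\delta(v)$ is the function with $\delta(v)(v,w)=1$ for all $w\neq v$, $\delta(v)(w,v)=1$ if $vw\in E(G)$, and $\delta(v)(x,y)=0$ otherwise; $\rho$ is the function with $\rho(v,w)=1$ for all $v\neq w$. Sums are pointwise over $GF(2)$. -}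

module Defs where

open import Data.Nat using (ℕ)
open import Data.Fin using (Fin)
open import Data.Bool using (Bool; true; false; _xor_; if_then_else_)
open import Relation.Binary.PropositionalEquality using (_≡_; _≢_)
open import Relation.Nullary using (¬_; Dec; does)
open import Data.Fin using (_≟_)

record Graph (n : ℕ) : Set₁ where
  field
    Adj    : Fin n → Fin n → Set
    adj?   : (v w : Fin n) → Dec (Adj v w)
    irrefl : (v : Fin n) → ¬ Adj v v
    sym    : (v w : Fin n) → Adj v w → Adj w v

-- GF(2) is modelled by Bool with xor as addition (false = 0, true = 1).
-- A function on ordered pairs of vertices; values on the diagonal (v,v)
-- are irrelevant (no equation mentions them).
PairFun : ℕ → Set
PairFun n = Fin n → Fin n → Bool

record IsNajiSolution {n : ℕ} (G : Graph n) (β : PairFun n) : Set where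
  open Graph G
  field
    eqA : (v w : Fin n) → v ≢ w → Adj v w → (β v w xor β w v) ≡ true
    eqB : (v w x : Fin n) → v ≢ w → v ≢ x → w ≢ x →
          Adj v w → ¬ Adj v x → ¬ Adj w x →
          (β x v xor β x w) ≡ false
    eqC : (v w x : Fin n) → v ≢ w → v ≢ x → w ≢ x →
          Adj v w → Adj v x → ¬ Adj w x →
          (β v w xor β v x xor β w x xor β x w) ≡ true

_⊕_ : {n : ℕ} → PairFun n → PairFun n → PairFun n
(f ⊕ g) x y = f x y xor g x y

ρ : {n : ℕ} → PairFun n
ρ _ _ = true

δ : {n : ℕ} → Graph n → Fin n → PairFun n
δ G v x y =
  if does (x ≟ v) then true
  else (if does (y ≟ v) then does (Graph.adj? G v x) else false)

-- The Naji equations are affine over GF(2), so adding a solution of the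
-- homogeneous system (every right-hand side replaced by 0) to a Naji solution
-- gives a Naji solution. ρ solves the homogeneous system because each equation
-- has an even number of terms. For δ(v) one checks the equations case by case
-- according to which of the vertices involved is v; the adjacency conditions of
-- each equation are exactly what makes the entries δ(v)(w,v) = [vw ∈ E] cancel.
module Submission where

open import Defs
open import Data.Nat using (ℕ)
open import Data.Fin using (Fin; _≟_)
open import Data.Product using (_×_; _,_)
open import Data.Bool using (false; _xor_)
open import Data.Bool.Properties using (xor-∧-commutativeRing)
open import Algebra.Bundles using (CommutativeRing)
open import Algebra.Properties.CommutativeSemigroup
  (CommutativeRing.+-commutativeSemigroup xor-∧-commutativeRing) using (interchange)
open import Data.Empty using (⊥-elim)
open import Function using (_∘_)
open import Relation.Nullary using (¬_; yes; no)
open import Relation.Nullary.Decidable using (dec-true; dec-false)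
open import Relation.Binary.PropositionalEquality

record IsHomogeneousNajiSolution {n : ℕ} (G : Graph n) (γ : PairFun n) : Set where
  open Graph G
  field
    eqA : (v w : Fin n) → v ≢ w → Adj v w → (γ v w xor γ w v) ≡ false
    eqB : (v w x : Fin n) → v ≢ w → v ≢ x → w ≢ x →
          Adj v w → ¬ Adj v x → ¬ Adj w x →
          (γ x v xor γ x w) ≡ false
    eqC : (v w x : Fin n) → v ≢ w → v ≢ x → w ≢ x →
          Adj v w → Adj v x → ¬ Adj w x →
          (γ v w xor γ v x xor γ w x xor γ x w) ≡ false

xor-interchange₄ : ∀ a b c d e f g h →
  ((a xor e) xor (b xor f) xor (c xor g) xor (d xor h)) ≡
  ((a xor b xor c xor d) xor (e xor f xor g xor h))
xor-interchange₄ a b c d e f g h = begin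
  (a xor e) xor (b xor f) xor (c xor g) xor (d xor h)
    ≡⟨ cong (λ t → (a xor e) xor (b xor f) xor t) (interchange c g d h) ⟩
  (a xor e) xor (b xor f) xor ((c xor d) xor (g xor h))
    ≡⟨ cong ((a xor e) xor_) (interchange b f (c xor d) (g xor h)) ⟩
  (a xor e) xor ((b xor c xor d) xor (f xor g xor h))
    ≡⟨ interchange a e (b xor c xor d) (f xor g xor h) ⟩
  (a xor b xor c xor d) xor (e xor f xor g xor h)
    ∎
  where open ≡-Reasoning

module _ {n : ℕ} {G : Graph n} {β γ : PairFun n} where

  ⊕-homogeneous : IsNajiSolution G β → IsHomogeneousNajiSolution G γ →
                  IsNajiSolution G (β ⊕ γ)
  ⊕-homogeneous S H = record
    { eqA = λ v w v≢w vw →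
        trans (interchange (β v w) (γ v w) (β w v) (γ w v))
              (cong₂ _xor_ (S.eqA v w v≢w vw) (H.eqA v w v≢w vw))
    ; eqB = λ v w x p q r s t u →
        trans (interchange (β x v) (γ x v) (β x w) (γ x w))
              (cong₂ _xor_ (S.eqB v w x p q r s t u) (H.eqB v w x p q r s t u))
    ; eqC = λ v w x p q r s t u →
        trans (xor-interchange₄ (β v w) (β v x) (β w x) (β x w)
                                (γ v w) (γ v x) (γ w x) (γ x w))
              (cong₂ _xor_ (S.eqC v w x p q r s t u) (H.eqC v w x p q r s t u))
    }
    where
    module S = IsNajiSolution S
    module H = IsHomogeneousNajiSolution H

ρ-homogeneous : {n : ℕ} (G : Graph n) → IsHomogeneousNajiSolution G ρ
ρ-homogeneous G = record
  { eqA = λ _ _ _ _ → refl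
  ; eqB = λ _ _ _ _ _ _ _ _ _ → refl
  ; eqC = λ _ _ _ _ _ _ _ _ _ → refl
  }

module _ {n : ℕ} (G : Graph n) (v : Fin n) where
  open Graph G renaming (sym to Adj-sym)

  δ-homogeneous : IsHomogeneousNajiSolution G (δ G v)
  δ-homogeneous = record { eqA = δ-eqA ; eqB = δ-eqB ; eqC = δ-eqC }
    where
    δ-eqA : ∀ a b → a ≢ b → Adj a b → (δ G v a b xor δ G v b a) ≡ false
    δ-eqA a b a≢b ab with a ≟ v | b ≟ v
    ... | yes refl | yes refl = ⊥-elim (a≢b refl)
    ... | yes refl | no _     rewrite dec-true (adj? a b) ab = refl
    ... | no _     | yes refl rewrite dec-true (adj? b a) (Adj-sym a b ab) = refl
    ... | no _     | no _     = refl

    δ-eqB : ∀ a b x → a ≢ b → a ≢ x → b ≢ x → Adj a b → ¬ Adj a x → ¬ Adj b x →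
            (δ G v x a xor δ G v x b) ≡ false
    δ-eqB a b x a≢b _ _ _ ¬ax ¬bx with x ≟ v | a ≟ v | b ≟ v
    ... | yes refl | _        | _        = refl
    ... | no _     | yes refl | yes refl = ⊥-elim (a≢b refl)
    ... | no _     | yes refl | no _     rewrite dec-false (adj? a x) ¬ax = refl
    ... | no _     | no _     | yes refl rewrite dec-false (adj? b x) ¬bx = refl
    ... | no _     | no _     | no _     = refl

    δ-eqC : ∀ a b x → a ≢ b → a ≢ x → b ≢ x → Adj a b → Adj a x → ¬ Adj b x →
            (δ G v a b xor δ G v a x xor δ G v b x xor δ G v x b) ≡ false
    δ-eqC a b x a≢b a≢x b≢x ab ax ¬bx with a ≟ v | b ≟ v | x ≟ v
    ... | yes refl | yes refl | _        = ⊥-elim (a≢b refl)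
    ... | yes refl | no _     | yes refl = ⊥-elim (a≢x refl)
    ... | yes refl | no _     | no _     = refl
    ... | no _     | yes refl | yes refl = ⊥-elim (b≢x refl)
    ... | no _     | yes refl | no _
      rewrite dec-true (adj? b a) (Adj-sym a b ab) | dec-false (adj? b x) ¬bx = refl
    ... | no _     | no _     | yes refl
      rewrite dec-true (adj? x a) (Adj-sym a x ax) | dec-false (adj? x b) (¬bx ∘ Adj-sym x b) = refl
    ... | no _     | no _     | no _     = refl

proposition7 : (n : ℕ) (G : Graph n) (β : PairFun n) →
    IsNajiSolution G β →
    IsNajiSolution G (β ⊕ ρ) × ((v : Fin n) → IsNajiSolution G (β ⊕ δ G v))
proposition7 n G β S =
  ⊕-homogeneous S (ρ-homogeneous G) , λ v → ⊕-homogeneous S (δ-homogeneous G v)
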